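{- Let $\mathbf d=(d_1,\ldots,d_n)$ be a degree sequence with $M=\sum_i d_i$, $M_2=\sum_i d_i(d_i-1)$, $\Delta=\max_i d_i$. Let $G\in\mathcal G_{m_1,m_2}$ with $m_1\le M_2/M$ and $m_2\le M_2^2/M^2$. Then $$M_2-8m_2\Delta-m_1\Delta^2\le b_\ell(G,\emptyset)\le M_2,$$ for every simple ordered 2-path $(v_1,v_2,v_3)$ in $G$, $$M-6\Delta^2+4\Delta\le b_\ell(G,v_1v_2v_3)\le M,$$ and $$m_1M^2\Bigl(1-\frac{11\Delta^2-4\Delta+4}{M}\Bigr)\le f_\ell(G)\le m_1M^2.$$
   Context: $\mathcal G_{m_1,m_2}$ is the set of multigraphs on $\{v_1,\ldots,v_n\}$ with degree sequence $\mathbf d$ (a loop contributes 2 to the degree) having exactly $m_1$ loops of multiplicity one, no loop of higher multiplicity, exactly $m_2$ double edges (pairs of distinct vertices joined by exactly two parallel edges) and no pair of vertices joined by three or more edges. A single edge is a pair of distinct vertices joined by exactly one edge; a non-edge is a pair of distinct vertices joined by no edge. A simple ordered edge is an ordered pair $(u,v)$ of distinct vertices with $uv$ a single edge; a simple ordered 2-path $uvw$ is an ordered triple $(u,v,w)$ of distinct vertices with $uv$ and $vw$ single edges. $b_\ell(G,\emptyset)$ is the number of simple ordered 2-paths $uvw$ in $G$ such that there is no loop at $v$. For a simple ordered 2-path $uvw$, $b_\ell(G,uvw)$ is the number of simple ordered edges $(u',w')$ with $u',w'\notin\{u,v,w\}$ such that $uu'$ and $ww'$ are non-edges. $f_\ell(G)$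 is the number of ordered 5-tuples $(v_1,\ldots,v_5)$ of distinct vertices such that there is a loop at $v_2$, $v_1v_4$ and $v_3v_5$ are single edges, and $v_1v_2$, $v_2v_3$, $v_4v_5$ are non-edges (the number of ways to perform an $\ell$-switching, which replaces the loop at $v_2$ and edges $v_1v_4,v_3v_5$ by $v_1v_2,v_2v_3,v_4v_5$). -}

module Defs where

open import Data.Nat using (ℕ; zero; suc; _+_; _*_; _∸_; _⊔_; _≤_; _<_)
import Data.Nat as ℕ
open import Data.Fin using (Fin)
import Data.Fin as Fin
open import Data.Product using (_×_)
open import Relation.Nullary using (Dec; yes; no; ¬_; ¬?)
open import Relation.Nullary.Decidable using (_×-dec_)
open import Relation.Binary.PropositionalEquality using (_≡_; _≢_)

∑ : ∀ {n} → (Fin n → ℕ) → ℕ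
∑ {zero}  f = 0
∑ {suc n} f = f Fin.zero + ∑ (λ i → f (Fin.suc i))

maxF : ∀ {n} → (Fin n → ℕ) → ℕ
maxF {zero}  f = 0
maxF {suc n} f = f Fin.zero ⊔ maxF (λ i → f (Fin.suc i))

𝟙 : ∀ {P : Set} → Dec P → ℕ
𝟙 (yes _) = 1
𝟙 (no _)  = 0

-- A multigraph on vertex set Fin n, given by its symmetric multiplicity
-- matrix: A u v = number of edges between u and v (u ≢ v);
-- A u u = number of loops at u.
MultiGraph : ℕ → Set
MultiGraph n = Fin n → Fin n → ℕ

Symmetric : ∀ {n} → MultiGraph n → Set
Symmetric {n} A = ∀ (u v : Fin n) → A u v ≡ A v u

-- degree: a loop contributes 2
deg : ∀ {n} → MultiGraph n → Fin n → ℕ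
deg A u = ∑ (λ v → A u v) + A u u

HasDegrees : ∀ {n} → MultiGraph n → (Fin n → ℕ) → Set
HasDegrees {n} A d = ∀ (u : Fin n) → deg A u ≡ d u

Msum : ∀ {n} → (Fin n → ℕ) → ℕ
Msum d = ∑ d

M₂ : ∀ {n} → (Fin n → ℕ) → ℕ
M₂ d = ∑ (λ i → d i * (d i ∸ 1))

Δ : ∀ {n} → (Fin n → ℕ) → ℕ
Δ d = maxF d

numLoops : ∀ {n} → MultiGraph n → ℕ
numLoops A = ∑ (λ u → 𝟙 (A u u ℕ.≟ 1))

numDoubles : ∀ {n} → MultiGraph n → ℕ
numDoubles A = ∑ (λ u → ∑ (λ v → 𝟙 ((u Fin.<? v) ×-dec (A u v ℕ.≟ 2))))

InG : ∀ {n} → (Fin n → ℕ) → ℕ → ℕ → MultiGraph n → Set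
InG {n} d m₁ m₂ A =
  Symmetric A × HasDegrees A d
  × (∀ (u : Fin n) → A u u ≤ 1)
  × (∀ (u v : Fin n) → u ≢ v → A u v ≤ 2)
  × numLoops A ≡ m₁
  × numDoubles A ≡ m₂

single? : ∀ {n} (A : MultiGraph n) (u v : Fin n) → Dec (u ≢ v × A u v ≡ 1)
single? A u v = ¬? (u Fin.≟ v) ×-dec (A u v ℕ.≟ 1)

nonEdge? : ∀ {n} (A : MultiGraph n) (u v : Fin n) → Dec (u ≢ v × A u v ≡ 0)
nonEdge? A u v = ¬? (u Fin.≟ v) ×-dec (A u v ℕ.≟ 0)

ne? : ∀ {n} (u v : Fin n) → Dec (u ≢ v)
ne? u v = ¬? (u Fin.≟ v)

Simple2Path : ∀ {n} → MultiGraph n → Fin n → Fin n → Fin n → Set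
Simple2Path A u v w = (u ≢ v × A u v ≡ 1) × (v ≢ w × A v w ≡ 1) × u ≢ w

simple2Path? : ∀ {n} (A : MultiGraph n) (u v w : Fin n) → Dec (Simple2Path A u v w)
simple2Path? A u v w = single? A u v ×-dec (single? A v w ×-dec ne? u w)

bEmpty : ∀ {n} → MultiGraph n → ℕ
bEmpty A = ∑ λ u → ∑ λ v → ∑ λ w → 𝟙 (simple2Path? A u v w ×-dec (A v v ℕ.≟ 0))

bPath : ∀ {n} → MultiGraph n → Fin n → Fin n → Fin n → ℕ
bPath A u v w = ∑ λ u' → ∑ λ w' → 𝟙
  (single? A u' w'
   ×-dec (ne? u' u ×-dec (ne? u' v ×-dec (ne? u' w
   ×-dec (ne? w' u ×-dec (ne? w' v ×-dec (ne? w' w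
   ×-dec (nonEdge? A u u' ×-dec nonEdge? A w w'))))))))

distinct5? : ∀ {n} (a b c d e : Fin n) →
  Dec (a ≢ b × a ≢ c × a ≢ d × a ≢ e × b ≢ c × b ≢ d × b ≢ e × c ≢ d × c ≢ e × d ≢ e)
distinct5? a b c d e =
  ne? a b ×-dec (ne? a c ×-dec (ne? a d ×-dec (ne? a e ×-dec (ne? b c
  ×-dec (ne? b d ×-dec (ne? b e ×-dec (ne? c d ×-dec (ne? c e ×-dec ne? d e))))))))

fℓ : ∀ {n} → MultiGraph n → ℕ
fℓ A = ∑ λ v₁ → ∑ λ v₂ → ∑ λ v₃ → ∑ λ v₄ → ∑ λ v₅ → 𝟙
  (distinct5? v₁ v₂ v₃ v₄ v₅
   ×-dec ((A v₂ v₂ ℕ.≟ 1)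
   ×-dec (single? A v₁ v₄ ×-dec (single? A v₃ v₅
   ×-dec (nonEdge? A v₁ v₂ ×-dec (nonEdge? A v₂ v₃ ×-dec nonEdge? A v₄ v₅))))))

module Submission where

-- Every multiplicity of G splits into a loop, a single edge and a double
-- edge, so d v = 2·[loop at v] + S v + 2·D v, where S v and D v count the
-- single and double edges at v; summing gives M = 2m₁ + T + 4m₂ with T the
-- number of ordered single edges.  Each quantity is then compared with a
-- simple product count by a union bound over "obstructions", charged to
-- closed neighbourhoods N[x] whose single-edge weight is at most Δ + Δ²:
--   b_ℓ(G,∅) = Σ_v [no loop at v]·S v(S v − 1), compared vertex by vertex with d v(d v − 1);
--   b_ℓ(G,uvw) ≥ T + 2 − (weights of N[u] and N[w]), by inclusion–exclusion;
--   f_ℓ(G) ≥ m₁T² − m₁T(3Δ² + 6Δ), by a union bound over the loop and two single edges.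
-- The hypotheses on m₁, m₂ give m₁ ≤ Δ − 1 and m₂ ≤ (Δ − 1)², which turn T into M.

open import Defs
open import Data.Nat using (ℕ; _≤_)
open import Data.Fin using (Fin)
open import Data.Product using (_×_; _,_)
open import Relation.Binary.PropositionalEquality using (_≢_; refl)

module Counting where

  open import Data.Nat using (zero; suc; _+_; _*_; z≤n; s≤s)
  open import Data.Nat.Properties
  import Data.Fin as Fin
  import Data.Fin.Properties as FinP
  open import Data.Empty using (⊥; ⊥-elim)
  open import Relation.Nullary using (Dec; yes; no; ¬_; ¬?)
  open import Relation.Nullary.Decidable using (_×-dec_)
  open import Relation.Binary.PropositionalEquality
  open import Algebra.Properties.Semiring.Sum +-*-semiring
    using (sum; ∑-distrib-+; ∑-comm; *-distribˡ-sum)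

  𝟙-yes : ∀ {P : Set} (p : Dec P) → P → 𝟙 p ≡ 1
  𝟙-yes (yes _) _ = refl
  𝟙-yes (no ¬p) p = ⊥-elim (¬p p)

  𝟙-no : ∀ {P : Set} (p : Dec P) → ¬ P → 𝟙 p ≡ 0
  𝟙-no (yes p) ¬p = ⊥-elim (¬p p)
  𝟙-no (no _)  _  = refl

  𝟙≤1 : ∀ {P : Set} (p : Dec P) → 𝟙 p ≤ 1
  𝟙≤1 (yes _) = s≤s z≤n
  𝟙≤1 (no _)  = z≤n

  𝟙≡1⇒ : ∀ {P : Set} (p : Dec P) → 𝟙 p ≡ 1 → P
  𝟙≡1⇒ (yes p) _ = p

  𝟙-mono : ∀ {P Q : Set} → (P → Q) → (p : Dec P) (q : Dec Q) → 𝟙 p ≤ 𝟙 q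
  𝟙-mono f (yes p) q = ≤-reflexive (sym (𝟙-yes q (f p)))
  𝟙-mono f (no _)  q = z≤n

  𝟙-cong : ∀ {P Q : Set} → (P → Q) → (Q → P) → (p : Dec P) (q : Dec Q) → 𝟙 p ≡ 𝟙 q
  𝟙-cong f g p q = ≤-antisym (𝟙-mono f p q) (𝟙-mono g q p)

  𝟙-× : ∀ {P Q : Set} (p : Dec P) (q : Dec Q) → 𝟙 (p ×-dec q) ≡ 𝟙 p * 𝟙 q
  𝟙-× (yes _) (yes _) = refl
  𝟙-× (yes _) (no _)  = refl
  𝟙-× (no _)  _       = refl

  𝟙-exclusive : ∀ {P Q : Set} → (P → Q → ⊥) → (p : Dec P) (q : Dec Q) → 𝟙 p + 𝟙 q ≤ 1
  𝟙-exclusive f (yes p) (yes q) = ⊥-elim (f p q)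
  𝟙-exclusive f (yes _) (no _)  = ≤-refl
  𝟙-exclusive f (no _)  q       = 𝟙≤1 q

  𝟙-¬ : ∀ {P : Set} (p : Dec P) → 𝟙 (¬? p) + 𝟙 p ≡ 1
  𝟙-¬ (yes _) = refl
  𝟙-¬ (no _)  = refl

  maxF-≥ : ∀ {n} (f : Fin n → ℕ) (i : Fin n) → f i ≤ maxF f
  maxF-≥ f Fin.zero    = m≤m⊔n _ _
  maxF-≥ f (Fin.suc i) = ≤-trans (maxF-≥ (λ j → f (Fin.suc j)) i) (m≤n⊔m _ _)

  ∑≡sum : ∀ {n} (f : Fin n → ℕ) → ∑ f ≡ sum f
  ∑≡sum {zero}  f = refl
  ∑≡sum {suc n} f = cong (f Fin.zero +_) (∑≡sum (λ i → f (Fin.suc i)))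

  ∑-cong : ∀ {n} {f g : Fin n → ℕ} → (∀ i → f i ≡ g i) → ∑ f ≡ ∑ g
  ∑-cong {zero}  e = refl
  ∑-cong {suc n} e = cong₂ _+_ (e Fin.zero) (∑-cong (λ i → e (Fin.suc i)))

  ∑-mono : ∀ {n} {f g : Fin n → ℕ} → (∀ i → f i ≤ g i) → ∑ f ≤ ∑ g
  ∑-mono {zero}  e = z≤n
  ∑-mono {suc n} e = +-mono-≤ (e Fin.zero) (∑-mono (λ i → e (Fin.suc i)))

  ∑-+ : ∀ {n} (f g : Fin n → ℕ) → ∑ (λ i → f i + g i) ≡ ∑ f + ∑ g
  ∑-+ f g = trans (∑≡sum (λ i → f i + g i))
                  (trans (∑-distrib-+ f g) (sym (cong₂ _+_ (∑≡sum f) (∑≡sum g))))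

  ∑-*ˡ : ∀ {n} (c : ℕ) (f : Fin n → ℕ) → ∑ (λ i → c * f i) ≡ c * ∑ f
  ∑-*ˡ c f = trans (∑≡sum (λ i → c * f i))
                   (trans (sym (*-distribˡ-sum c f)) (cong (c *_) (sym (∑≡sum f))))

  ∑-*ʳ : ∀ {n} (c : ℕ) (f : Fin n → ℕ) → ∑ (λ i → f i * c) ≡ ∑ f * c
  ∑-*ʳ c f = trans (∑-cong (λ i → *-comm (f i) c)) (trans (∑-*ˡ c f) (*-comm c (∑ f)))

  ∑-swap : ∀ {m n} (f : Fin m → Fin n → ℕ) → ∑ (λ i → ∑ (f i)) ≡ ∑ (λ j → ∑ (λ i → f i j))
  ∑-swap f = trans (as-sum f) (trans (∑-comm f) (sym (as-sum (λ j i → f i j))))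
    where
    as-sum : ∀ {m n} (g : Fin m → Fin n → ℕ) → ∑ (λ i → ∑ (g i)) ≡ sum (λ i → sum (g i))
    as-sum g = trans (∑-cong (λ i → ∑≡sum (g i))) (∑≡sum (λ i → sum (g i)))

  δ : ∀ {n} → Fin n → Fin n → ℕ
  δ i j = 𝟙 (i Fin.≟ j)

  δ-suc : ∀ {n} (i j : Fin n) → δ (Fin.suc i) (Fin.suc j) ≡ δ i j
  δ-suc i j = 𝟙-cong FinP.suc-injective (cong Fin.suc) (Fin.suc i Fin.≟ Fin.suc j) (i Fin.≟ j)

  ∑-δ : ∀ {n} (f : Fin n → ℕ) (i : Fin n) → ∑ (λ j → f j * δ j i) ≡ f i
  ∑-δ {suc n} f Fin.zero = begin
    f Fin.zero * 1 + ∑ (λ j → f (Fin.suc j) * 0)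
      ≡⟨ cong₂ _+_ (*-identityʳ (f Fin.zero)) (trans (∑-*ʳ 0 (λ j → f (Fin.suc j))) (*-zeroʳ (∑ (λ j → f (Fin.suc j))))) ⟩
    f Fin.zero + 0   ≡⟨ +-identityʳ _ ⟩
    f Fin.zero       ∎
    where open ≡-Reasoning
  ∑-δ {suc n} f (Fin.suc i) = begin
    f Fin.zero * 0 + ∑ (λ j → f (Fin.suc j) * δ (Fin.suc j) (Fin.suc i))
      ≡⟨ cong₂ _+_ (*-zeroʳ (f Fin.zero)) (∑-cong (λ j → cong (f (Fin.suc j) *_) (δ-suc j i))) ⟩
    ∑ (λ j → f (Fin.suc j) * δ j i)   ≡⟨ ∑-δ (λ j → f (Fin.suc j)) i ⟩
    f (Fin.suc i)                     ∎
    where open ≡-Reasoning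

  ∑-two-terms : ∀ {n} (f : Fin n → ℕ) {i j : Fin n} → i ≢ j → f i + f j ≤ ∑ f
  ∑-two-terms f {i} {j} i≢j = begin
    f i + f j                                 ≡⟨ sym (cong₂ _+_ (∑-δ f i) (∑-δ f j)) ⟩
    ∑ (λ k → f k * δ k i) + ∑ (λ k → f k * δ k j) ≡⟨ sym (∑-+ (λ k → f k * δ k i) (λ k → f k * δ k j)) ⟩
    ∑ (λ k → f k * δ k i + f k * δ k j)       ≡⟨ ∑-cong (λ k → sym (*-distribˡ-+ (f k) _ _)) ⟩
    ∑ (λ k → f k * (δ k i + δ k j))           ≤⟨ ∑-mono (λ k → *-monoʳ-≤ (f k) (at-most-one k)) ⟩
    ∑ (λ k → f k * 1)                         ≡⟨ ∑-cong (λ k → *-identityʳ (f k)) ⟩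
    ∑ f                                       ∎
    where
    open ≤-Reasoning
    at-most-one : ∀ k → δ k i + δ k j ≤ 1
    at-most-one k = 𝟙-exclusive (λ k≡i k≡j → i≢j (trans (sym k≡i) k≡j)) (k Fin.≟ i) (k Fin.≟ j)

  ∑-term : ∀ {n} (f : Fin n → ℕ) (i : Fin n) → f i ≤ ∑ f
  ∑-term f i = begin
    f i                   ≡⟨ sym (∑-δ f i) ⟩
    ∑ (λ k → f k * δ k i) ≤⟨ ∑-mono (λ k → *-monoʳ-≤ (f k) (𝟙≤1 (k Fin.≟ i))) ⟩
    ∑ (λ k → f k * 1)     ≡⟨ ∑-cong (λ k → *-identityʳ (f k)) ⟩
    ∑ f                   ∎
    where open ≤-Reasoning

  ∑² : ∀ {n} → (Fin n → Fin n → ℕ) → ℕ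
  ∑² f = ∑ (λ a → ∑ (λ b → f a b))

  ∑²-mono : ∀ {n} {f g : Fin n → Fin n → ℕ} → (∀ a b → f a b ≤ g a b) → ∑² f ≤ ∑² g
  ∑²-mono e = ∑-mono (λ a → ∑-mono (e a))

  ∑²-cong : ∀ {n} {f g : Fin n → Fin n → ℕ} → (∀ a b → f a b ≡ g a b) → ∑² f ≡ ∑² g
  ∑²-cong e = ∑-cong (λ a → ∑-cong (e a))

  ∑²-+ : ∀ {n} (f g : Fin n → Fin n → ℕ) → ∑² (λ a b → f a b + g a b) ≡ ∑² f + ∑² g
  ∑²-+ f g = trans (∑-cong (λ a → ∑-+ (f a) (g a))) (∑-+ (λ a → ∑ (f a)) (λ a → ∑ (g a)))

  ∑²-*ˡ : ∀ {n} (c : ℕ) (f : Fin n → Fin n → ℕ) → ∑² (λ a b → c * f a b) ≡ c * ∑² f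
  ∑²-*ˡ c f = trans (∑-cong (λ a → ∑-*ˡ c (f a))) (∑-*ˡ c (λ a → ∑ (f a)))

  ∑²-*ʳ : ∀ {n} (c : ℕ) (f : Fin n → Fin n → ℕ) → ∑² (λ a b → f a b * c) ≡ ∑² f * c
  ∑²-*ʳ c f = trans (∑²-cong (λ a b → *-comm (f a b) c)) (trans (∑²-*ˡ c f) (*-comm c (∑² f)))

  ∑⁴ : ∀ {n} → (Fin n → Fin n → Fin n → Fin n → ℕ) → ℕ
  ∑⁴ F = ∑² (λ a b → ∑² (F a b))

  ∑⁴-mono : ∀ {n} {F G : Fin n → Fin n → Fin n → Fin n → ℕ} →
            (∀ a b c e → F a b c e ≤ G a b c e) → ∑⁴ F ≤ ∑⁴ G
  ∑⁴-mono e = ∑²-mono (λ a b → ∑²-mono (e a b))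

  ∑⁴-+ : ∀ {n} (F G : Fin n → Fin n → Fin n → Fin n → ℕ) →
         ∑⁴ (λ a b c e → F a b c e + G a b c e) ≡ ∑⁴ F + ∑⁴ G
  ∑⁴-+ F G = trans (∑²-cong (λ a b → ∑²-+ (F a b) (G a b))) (∑²-+ (λ a b → ∑² (F a b)) (λ a b → ∑² (G a b)))

  ∑⁴-*ˡ : ∀ {n} (c : ℕ) (F : Fin n → Fin n → Fin n → Fin n → ℕ) →
          ∑⁴ (λ a b x y → c * F a b x y) ≡ c * ∑⁴ F
  ∑⁴-*ˡ c F = trans (∑²-cong (λ a b → ∑²-*ˡ c (F a b))) (∑²-*ˡ c (λ a b → ∑² (F a b)))

module Arithmetic where

  open import Data.Nat using (zero; suc; _+_; _*_; _∸_; z≤n; s≤s)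
  open import Data.Nat.Properties
  open import Relation.Binary.PropositionalEquality
  open import Data.Nat.Tactic.RingSolver using (solve-∀)

  inclusion-exclusion : ∀ {s x y g} → s ≤ 1 → x ≤ 1 → y ≤ 1 → (s ≡ 1 → 1 ≤ x + y + g) →
                        s + s * (x * y) ≤ g + s * x + s * y
  inclusion-exclusion z≤n _ _ _ = z≤n
  inclusion-exclusion {g = g} (s≤s z≤n) z≤n z≤n h =
    ≤-trans (h refl) (≤-reflexive (sym (trans (+-identityʳ (g + 0)) (+-identityʳ g))))
  inclusion-exclusion (s≤s z≤n) (s≤s z≤n) z≤n _ = +-monoˡ-≤ 0 (+-monoˡ-≤ 1 z≤n)
  inclusion-exclusion (s≤s z≤n) z≤n (s≤s z≤n) _ = +-monoˡ-≤ 1 (+-monoˡ-≤ 0 z≤n)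
  inclusion-exclusion (s≤s z≤n) (s≤s z≤n) (s≤s z≤n) _ = +-monoˡ-≤ 1 (+-monoˡ-≤ 1 z≤n)

  union-bound : ∀ {x b g} → x ≤ 1 → (x ≡ 1 → 1 ≤ b + g) → x ≤ g + x * b
  union-bound z≤n _ = z≤n
  union-bound {b = b} {g} (s≤s z≤n) h =
    ≤-trans (h refl) (≤-reflexive (trans (+-comm b g) (cong (g +_) (sym (+-identityʳ b)))))

  *-∸-self : ∀ x y → x ≤ 1 → x * (y ∸ x) ≡ x * (y ∸ 1)
  *-∸-self zero    y _         = refl
  *-∸-self (suc zero) y _      = refl
  *-∸-self (suc (suc _)) _ (s≤s ())

  ordered-pairs-growth : ∀ s y D → s + y ≤ D → (s + y) * (s + y ∸ 1) ≤ s * (s ∸ 1) + y * (2 * D)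
  ordered-pairs-growth zero y D y≤D = begin
    y * (y ∸ 1) ≤⟨ *-monoʳ-≤ y (≤-trans (m∸n≤m y 1) y≤D) ⟩
    y * D       ≤⟨ *-monoʳ-≤ y (m≤n*m D 2) ⟩
    y * (2 * D) ∎
    where open ≤-Reasoning
  ordered-pairs-growth (suc s) y D s+y≤D = begin
    (suc s + y) * (s + y)             ≡⟨ expand s y ⟩
    suc s * s + y * (2 * s + 1 + y)   ≤⟨ +-monoʳ-≤ (suc s * s) (*-monoʳ-≤ y (≤-trans (m≤m+n _ (1 + y)) twice)) ⟩
    suc s * s + y * (2 * D)           ∎
    where
    open ≤-Reasoning
    expand : ∀ s y → (suc s + y) * (s + y) ≡ suc s * s + y * (2 * s + 1 + y)
    expand = solve-∀
    twice : 2 * s + 1 + y + (1 + y) ≤ 2 * D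
    twice = ≤-trans (≤-reflexive (e s y)) (*-monoʳ-≤ 2 s+y≤D)
      where
      e : ∀ s y → 2 * s + 1 + y + (1 + y) ≡ 2 * (suc s + y)
      e = solve-∀

  cancel-≤ : ∀ {x c M} → x * M ≤ c * M → (M ≡ 0 → x ≡ 0) → x ≤ c
  cancel-≤ {M = zero}  _ x≡0 = ≤-trans (≤-reflexive (x≡0 refl)) z≤n
  cancel-≤ {x} {c} {M = suc M} le _ = *-cancelʳ-≤ x c (suc M) le

  square-growth : ∀ {m T X Y K f} → X ≤ Y → m * (T * T) ≤ f + m * (T * K) →
                  m * ((T + X) * (T + X)) ≤ f + m * (T + X) * (K + 2 * Y)
  square-growth {m} {T} {X} {Y} {K} {f} X≤Y h = begin
    m * ((T + X) * (T + X))                          ≡⟨ e₁ m T X ⟩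
    m * (T * T) + m * (X * (2 * T + X))              ≤⟨ +-mono-≤ h (*-monoʳ-≤ m cross) ⟩
    f + m * (T * K) + m * ((T + X) * (2 * Y))        ≤⟨ +-monoˡ-≤ _ (+-monoʳ-≤ f (*-monoʳ-≤ m (*-monoˡ-≤ K (m≤m+n T X)))) ⟩
    f + m * ((T + X) * K) + m * ((T + X) * (2 * Y))  ≡⟨ e₂ f m T X K Y ⟩
    f + m * (T + X) * (K + 2 * Y)                    ∎
    where
    open ≤-Reasoning
    e₁ : ∀ m T X → m * ((T + X) * (T + X)) ≡ m * (T * T) + m * (X * (2 * T + X))
    e₁ = solve-∀
    e₂ : ∀ f m T X K Y → f + m * ((T + X) * K) + m * ((T + X) * (2 * Y)) ≡ f + m * (T + X) * (K + 2 * Y)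
    e₂ = solve-∀
    cross : X * (2 * T + X) ≤ (T + X) * (2 * Y)
    cross = begin
      X * (2 * T + X)       ≤⟨ *-monoʳ-≤ X (+-monoʳ-≤ (2 * T) (m≤n+m X X)) ⟩
      X * (2 * T + (X + X)) ≡⟨ e₃ X T ⟩
      (T + X) * (2 * X)     ≤⟨ *-monoʳ-≤ (T + X) (*-monoʳ-≤ 2 X≤Y) ⟩
      (T + X) * (2 * Y)     ∎
      where
      e₃ : ∀ X T → X * (2 * T + (X + X)) ≡ (T + X) * (2 * X)
      e₃ = solve-∀

  -- The b_ℓ(G,uvw) bound: with m₁ ≤ Δ − 1 loops and m₂ ≤ (Δ − 1)² double edges,
  -- M = 2m₁ + T + 4m₂ and T + 2 ≤ b + 2(Δ + Δ²) give M + 4Δ ≤ b + 6Δ².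
  two-path-arith : ∀ {T b m₁ m₂} Δ → 1 ≤ Δ → m₁ ≤ Δ ∸ 1 → m₂ ≤ (Δ ∸ 1) * (Δ ∸ 1) →
                   T + 2 ≤ b + (Δ + Δ * Δ) + (Δ + Δ * Δ) →
                   2 * m₁ + T + 2 * (2 * m₂) + 4 * Δ ≤ b + 6 * (Δ * Δ)
  two-path-arith {T} {b} {m₁} {m₂} (suc k) _ m₁≤ m₂≤ h = begin
    2 * m₁ + T + 2 * (2 * m₂) + 4 * suc k
      ≤⟨ +-monoˡ-≤ (4 * suc k) (+-mono-≤ (+-monoˡ-≤ T (*-monoʳ-≤ 2 m₁≤)) (*-monoʳ-≤ 2 (*-monoʳ-≤ 2 m₂≤))) ⟩
    2 * k + T + 2 * (2 * (k * k)) + 4 * suc k                                  ≡⟨ e₁ k T ⟩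
    (T + 2) + (4 * (k * k) + 6 * k + 2)                                        ≤⟨ +-monoˡ-≤ _ h ⟩
    b + (suc k + suc k * suc k) + (suc k + suc k * suc k) + (4 * (k * k) + 6 * k + 2) ≡⟨ e₂ b k ⟩
    b + 6 * (suc k * suc k)                                                    ∎
    where
    open ≤-Reasoning
    e₁ : ∀ k T → 2 * k + T + 2 * (2 * (k * k)) + 4 * suc k ≡ (T + 2) + (4 * (k * k) + 6 * k + 2)
    e₁ = solve-∀
    e₂ : ∀ b k → b + (suc k + suc k * suc k) + (suc k + suc k * suc k) + (4 * (k * k) + 6 * k + 2)
                 ≡ b + 6 * (suc k * suc k)
    e₂ = solve-∀

  -- 11Δ² − 4Δ + 4 as a natural number (written in k = Δ − 1 when Δ ≥ 1).
  switching-constant : ℕ → ℕ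
  switching-constant zero    = 4
  switching-constant (suc k) = 11 * (k * k) + 18 * k + 11

  -- The f_ℓ bound: from m·T² ≤ f + m·T·(3Δ² + 6Δ), m ≤ Δ − 1 and X ≤ 2(Δ − 1) + 4(Δ − 1)²
  -- follows m·M² ≤ f + m·M·(11Δ² − 4Δ + 4) for M = T + X.
  switching-arith : ∀ {m T X f} Δ → m ≤ Δ ∸ 1 → X ≤ 2 * (Δ ∸ 1) + 2 * (2 * ((Δ ∸ 1) * (Δ ∸ 1))) →
                    m * (T * T) ≤ f + m * (T * (3 * (Δ * Δ) + 6 * Δ)) →
                    m * ((T + X) * (T + X)) ≤ f + m * (T + X) * switching-constant Δ
  switching-arith zero z≤n _ _ = z≤n
  switching-arith {m} {T} {X} {f} (suc k) _ X≤ h =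
    ≤-trans (square-growth {m} {T} {X} {_} {3 * (suc k * suc k) + 6 * suc k} {f} X≤ h)
            (+-monoʳ-≤ f (*-monoʳ-≤ (m * (T + X)) constant))
    where
    e : ∀ k → 3 * (suc k * suc k) + 6 * suc k + 2 * (2 * k + 2 * (2 * (k * k))) + (2 * k + 2)
              ≡ 11 * (k * k) + 18 * k + 11
    e = solve-∀
    constant : 3 * (suc k * suc k) + 6 * suc k + 2 * (2 * k + 2 * (2 * (k * k))) ≤ switching-constant (suc k)
    constant = ≤-trans (m≤m+n _ (2 * k + 2)) (≤-reflexive (e k))

module Structure {n : ℕ} (A : MultiGraph n) (A-sym : Symmetric A)
                 (loop≤1 : ∀ u → A u u ≤ 1) (mult≤2 : ∀ u v → u ≢ v → A u v ≤ 2) where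

  open import Data.Nat using (zero; suc; _+_; _*_; _∸_; z≤n; s≤s)
  import Data.Nat as ℕ
  open import Data.Nat.Properties
  import Data.Fin as Fin
  import Data.Fin.Properties as FinP
  open import Data.Product using (_,_; proj₁; proj₂)
  open import Data.Sum using (_⊎_; inj₁; inj₂; [_,_]′)
  open import Function using (id)
  open import Data.Empty using (⊥-elim)
  open import Relation.Nullary using (Dec; yes; no; ¬?)
  open import Relation.Nullary.Decidable using (_×-dec_)
  open import Relation.Binary using (tri<; tri≈; tri>)
  open import Relation.Binary.PropositionalEquality
  open import Data.Nat.Tactic.RingSolver using (solve-∀)
  open import Algebra.Properties.CommutativeSemigroup *-commutativeSemigroup using (x∙yz≈y∙xz)
  open Counting
  open Arithmetic

  sg : Fin n → Fin n → ℕ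
  sg a b = 𝟙 (single? A a b)

  S : Fin n → ℕ
  S a = ∑ (sg a)

  T : ℕ
  T = ∑ S

  -- N[ x ] y: y lies in the closed neighbourhood of x (y = x or y is joined to x).
  N[_] : Fin n → Fin n → ℕ
  N[ x ] y = 𝟙 (¬? (nonEdge? A x y))

  dbl : Fin n → Fin n → ℕ
  dbl a b = 𝟙 (ne? a b ×-dec (A a b ℕ.≟ 2))

  D : Fin n → ℕ
  D a = ∑ (dbl a)

  L : Fin n → ℕ
  L a = 𝟙 (A a a ℕ.≟ 1)

  sg-sym : ∀ a b → sg a b ≡ sg b a
  sg-sym a b = 𝟙-cong flip flip (single? A a b) (single? A b a)
    where
    flip : ∀ {x y} → x ≢ y × A x y ≡ 1 → y ≢ x × A y x ≡ 1
    flip (x≢y , e) = ≢-sym x≢y , trans (A-sym _ _) e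

  sg≤A : ∀ a b → sg a b ≤ A a b
  sg≤A a b with single? A a b
  ... | yes (_ , e) = ≤-reflexive (sym e)
  ... | no _        = z≤n

  loop-cases : ∀ v → A v v ≡ 0 ⊎ A v v ≡ 1
  loop-cases v with A v v | loop≤1 v
  ... | zero     | _ = inj₁ refl
  ... | suc zero | _ = inj₂ refl
  ... | suc (suc _) | s≤s ()

  loop≡L : ∀ v → A v v ≡ L v
  loop≡L v with loop-cases v
  ... | inj₁ e = trans e (sym (𝟙-no (A v v ℕ.≟ 1) (λ e′ → 0≢1+n (trans (sym e) e′))))
  ... | inj₂ e = trans e (sym (𝟙-yes (A v v ℕ.≟ 1) e))

  N-self : ∀ x → N[ x ] x ≡ 1
  N-self x = 𝟙-yes (¬? (nonEdge? A x x)) (λ (x≢x , _) → x≢x refl)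

  N-single : ∀ x y → A x y ≡ 1 → N[ x ] y ≡ 1
  N-single x y e = 𝟙-yes (¬? (nonEdge? A x y)) (λ (_ , e′) → 0≢1+n (trans (sym e′) e))

  N≤ : ∀ x y → N[ x ] y ≤ δ y x + A x y
  N≤ x y with nonEdge? A x y | y Fin.≟ x
  ... | yes _    | _        = z≤n
  ... | no _     | yes _    = s≤s z≤n
  ... | no ¬none | no y≢x   = n≢0⇒n>0 (λ e → ¬none ((λ x≡y → y≢x (sym x≡y)) , e))

  mult-split : ∀ u v → A u v ≡ δ v u * A u u + sg u v + 2 * dbl u v
  mult-split u v with v Fin.≟ u
  ... | yes refl = sym (begin
          1 * A v v + sg v v + 2 * dbl v v ≡⟨ cong₂ (λ s t → 1 * A v v + s + 2 * t) not-single not-double ⟩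
          1 * A v v + 0 + 2 * 0            ≡⟨ e (A v v) ⟩
          A v v                            ∎)
    where
    open ≡-Reasoning
    not-single : sg v v ≡ 0
    not-single = 𝟙-no (single? A v v) (λ (v≢v , _) → v≢v refl)
    not-double : dbl v v ≡ 0
    not-double = 𝟙-no (ne? v v ×-dec (A v v ℕ.≟ 2)) (λ (v≢v , _) → v≢v refl)
    e : ∀ a → 1 * a + 0 + 2 * 0 ≡ a
    e = solve-∀
  ... | no v≢u = by-value (ne? u v) (A u v) (mult≤2 u v (≢-sym v≢u))
    where
    by-value : (p : Dec (u ≢ v)) → ∀ k → k ≤ 2 → k ≡ 𝟙 (p ×-dec (k ℕ.≟ 1)) + 2 * 𝟙 (p ×-dec (k ℕ.≟ 2))
    by-value (no u≡v) _ _ = ⊥-elim (u≡v (≢-sym v≢u))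
    by-value (yes _) zero _ = refl
    by-value (yes _) (suc zero) _ = refl
    by-value (yes _) (suc (suc zero)) _ = refl
    by-value (yes _) (suc (suc (suc _))) (s≤s (s≤s ()))

  degree-split : ∀ u → deg A u ≡ 2 * L u + S u + 2 * D u
  degree-split u = begin
    ∑ (A u) + A u u                                                  ≡⟨ cong (_+ A u u) (∑-cong (mult-split u)) ⟩
    ∑ (λ v → δ v u * A u u + sg u v + 2 * dbl u v) + A u u           ≡⟨ cong (_+ A u u) row ⟩
    A u u + S u + 2 * D u + A u u                                    ≡⟨ e (A u u) (S u) (D u) ⟩
    2 * A u u + S u + 2 * D u                                        ≡⟨ cong (λ l → 2 * l + S u + 2 * D u) (loop≡L u) ⟩
    2 * L u + S u + 2 * D u                                          ∎
    where
    open ≡-Reasoning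
    e : ∀ a s t → a + s + 2 * t + a ≡ 2 * a + s + 2 * t
    e = solve-∀
    row : ∑ (λ v → δ v u * A u u + sg u v + 2 * dbl u v) ≡ A u u + S u + 2 * D u
    row = begin
      ∑ (λ v → δ v u * A u u + sg u v + 2 * dbl u v)
        ≡⟨ trans (∑-+ _ (λ v → 2 * dbl u v)) (cong₂ _+_ (∑-+ (λ v → δ v u * A u u) (sg u)) (∑-*ˡ 2 (dbl u))) ⟩
      ∑ (λ v → δ v u * A u u) + S u + 2 * D u
        ≡⟨ cong (λ x → x + S u + 2 * D u) (trans (∑-cong (λ v → *-comm (δ v u) (A u u))) (∑-δ (λ _ → A u u) u)) ⟩
      A u u + S u + 2 * D u ∎

  doubleUp : Fin n → Fin n → ℕ
  doubleUp u v = 𝟙 ((u Fin.<? v) ×-dec (A u v ℕ.≟ 2))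

  dbl-split : ∀ u v → dbl u v ≡ doubleUp u v + doubleUp v u
  dbl-split u v with FinP.<-cmp u v
  ... | tri< u<v _ v≮u = trans (𝟙-cong (λ (_ , e) → u<v , e) (λ (_ , e) → FinP.<⇒≢ u<v , e)
                                        (ne? u v ×-dec (A u v ℕ.≟ 2)) ((u Fin.<? v) ×-dec (A u v ℕ.≟ 2)))
                                (sym (trans (cong (doubleUp u v +_) (𝟙-no ((v Fin.<? u) ×-dec _) (λ (v<u , _) → v≮u v<u)))
                                            (+-identityʳ _)))
  ... | tri≈ _ u≡v _ = trans (𝟙-no (ne? u v ×-dec _) (λ (u≢v , _) → u≢v u≡v))
                             (sym (cong₂ _+_ (𝟙-no ((u Fin.<? v) ×-dec _) (λ (u<v , _) → FinP.<⇒≢ u<v u≡v))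
                                             (𝟙-no ((v Fin.<? u) ×-dec _) (λ (v<u , _) → FinP.<⇒≢ v<u (sym u≡v)))))
  ... | tri> u≮v _ v<u = trans (𝟙-cong (λ (_ , e) → v<u , trans (A-sym v u) e)
                                        (λ (_ , e) → ≢-sym (FinP.<⇒≢ v<u) , trans (A-sym u v) e)
                                        (ne? u v ×-dec (A u v ℕ.≟ 2)) ((v Fin.<? u) ×-dec (A v u ℕ.≟ 2)))
                                (sym (cong (_+ doubleUp v u) (𝟙-no ((u Fin.<? v) ×-dec _) (λ (u<v , _) → u≮v u<v))))

  doubles-twice : ∑ D ≡ 2 * numDoubles A
  doubles-twice = begin
    ∑ (λ u → ∑ (dbl u))
      ≡⟨ ∑-cong (λ u → trans (∑-cong (dbl-split u)) (∑-+ (doubleUp u) (λ v → doubleUp v u))) ⟩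
    ∑ (λ u → ∑ (doubleUp u) + ∑ (λ v → doubleUp v u))
      ≡⟨ ∑-+ (λ u → ∑ (doubleUp u)) (λ u → ∑ (λ v → doubleUp v u)) ⟩
    numDoubles A + ∑ (λ u → ∑ (λ v → doubleUp v u))  ≡⟨ cong (numDoubles A +_) (∑-swap (λ u v → doubleUp v u)) ⟩
    numDoubles A + numDoubles A                      ≡⟨ cong (numDoubles A +_) (sym (+-identityʳ _)) ⟩
    2 * numDoubles A                                 ∎
    where open ≡-Reasoning

  edgeSum : (Fin n → Fin n → ℕ) → ℕ
  edgeSum g = ∑² (λ a b → sg a b * g a b)

  edgeSum-mono : ∀ {f g : Fin n → Fin n → ℕ} → (∀ a b → f a b ≤ g a b) → edgeSum f ≤ edgeSum g
  edgeSum-mono h = ∑²-mono (λ a b → *-monoʳ-≤ (sg a b) (h a b))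

  edgeSum-+≤ : ∀ {f g : Fin n → Fin n → ℕ} {x y} → edgeSum f ≤ x → edgeSum g ≤ y →
               edgeSum (λ a b → f a b + g a b) ≤ x + y
  edgeSum-+≤ {f} {g} f≤ g≤ = ≤-trans
    (≤-reflexive (trans (∑²-cong (λ a b → *-distribˡ-+ (sg a b) (f a b) (g a b)))
                        (∑²-+ (λ a b → sg a b * f a b) (λ a b → sg a b * g a b))))
    (+-mono-≤ f≤ g≤)

  edgeSum-left : ∀ (f : Fin n → ℕ) → edgeSum (λ a b → f a) ≡ ∑ (λ a → S a * f a)
  edgeSum-left f = ∑-cong (λ a → ∑-*ʳ (f a) (sg a))

  edgeSum-right : ∀ (f : Fin n → ℕ) → edgeSum (λ a b → f b) ≡ ∑ (λ b → S b * f b)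
  edgeSum-right f = trans (∑-swap (λ a b → sg a b * f b)) (∑-cong column)
    where
    column : ∀ b → ∑ (λ a → sg a b * f b) ≡ S b * f b
    column b = trans (∑-*ʳ (f b) (λ a → sg a b)) (cong (_* f b) (∑-cong (λ a → sg-sym a b)))

  edgeSum-const : ∀ k → edgeSum (λ _ _ → k) ≡ T * k
  edgeSum-const k = trans (edgeSum-left (λ _ → k)) (∑-*ʳ k S)

  -- b_ℓ(G,∅) as a vertex sum: a loop-free vertex v with S v single edges is the
  -- centre of S v (S v − 1) simple ordered 2-paths.
  noLoop : Fin n → ℕ
  noLoop v = 𝟙 (A v v ℕ.≟ 0)

  cherries : Fin n → ℕ
  cherries v = noLoop v * (S v * (S v ∸ 1))

  others : ∀ u v → ∑ (λ w → sg v w * 𝟙 (ne? u w)) ≡ S v ∸ sg v u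
  others u v = sym (trans (cong (_∸ sg v u) split) (m+n∸n≡m _ (sg v u)))
    where
    open ≡-Reasoning
    one : ∀ w → sg v w * 𝟙 (ne? u w) + sg v w * δ w u ≡ sg v w
    one w = begin
      sg v w * 𝟙 (ne? u w) + sg v w * δ w u ≡⟨ *-distribˡ-+ (sg v w) (𝟙 (ne? u w)) (δ w u) ⟨
      sg v w * (𝟙 (ne? u w) + δ w u)
        ≡⟨ cong (λ x → sg v w * (𝟙 (ne? u w) + x)) (𝟙-cong sym sym (w Fin.≟ u) (u Fin.≟ w)) ⟩
      sg v w * (𝟙 (ne? u w) + δ u w)        ≡⟨ cong (sg v w *_) (𝟙-¬ (u Fin.≟ w)) ⟩
      sg v w * 1                            ≡⟨ *-identityʳ (sg v w) ⟩
      sg v w                                ∎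
    split : S v ≡ ∑ (λ w → sg v w * 𝟙 (ne? u w)) + sg v u
    split = begin
      ∑ (sg v)
        ≡⟨ ∑-cong (λ w → sym (one w)) ⟩
      ∑ (λ w → sg v w * 𝟙 (ne? u w) + sg v w * δ w u)
        ≡⟨ ∑-+ (λ w → sg v w * 𝟙 (ne? u w)) (λ w → sg v w * δ w u) ⟩
      ∑ (λ w → sg v w * 𝟙 (ne? u w)) + ∑ (λ w → sg v w * δ w u)
        ≡⟨ cong (∑ (λ w → sg v w * 𝟙 (ne? u w)) +_) (∑-δ (sg v) u) ⟩
      ∑ (λ w → sg v w * 𝟙 (ne? u w)) + sg v u
        ∎

  paths-through : ∀ u v → ∑ (λ w → 𝟙 (simple2Path? A u v w ×-dec (A v v ℕ.≟ 0))) ≡ noLoop v * (sg v u * (S v ∸ 1))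
  paths-through u v = begin
    ∑ (λ w → 𝟙 (simple2Path? A u v w ×-dec (A v v ℕ.≟ 0)))
      ≡⟨ ∑-cong factor ⟩
    ∑ (λ w → noLoop v * (sg u v * (sg v w * ne u w)))
      ≡⟨ trans (∑-*ˡ (noLoop v) (λ w → sg u v * (sg v w * ne u w)))
               (cong (noLoop v *_) (∑-*ˡ (sg u v) (λ w → sg v w * ne u w))) ⟩
    noLoop v * (sg u v * ∑ (λ w → sg v w * ne u w))      ≡⟨ cong (λ x → noLoop v * (sg u v * x)) (others u v) ⟩
    noLoop v * (sg u v * (S v ∸ sg v u))                 ≡⟨ cong (λ x → noLoop v * (x * (S v ∸ sg v u))) (sg-sym u v) ⟩
    noLoop v * (sg v u * (S v ∸ sg v u))
      ≡⟨ cong (noLoop v *_) (*-∸-self (sg v u) (S v) (𝟙≤1 (single? A v u))) ⟩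
    noLoop v * (sg v u * (S v ∸ 1))                      ∎
    where
    open ≡-Reasoning
    ne : Fin n → Fin n → ℕ
    ne u w = 𝟙 (ne? u w)
    factor : ∀ w → 𝟙 (simple2Path? A u v w ×-dec (A v v ℕ.≟ 0)) ≡ noLoop v * (sg u v * (sg v w * ne u w))
    factor w = begin
      𝟙 (simple2Path? A u v w ×-dec (A v v ℕ.≟ 0)) ≡⟨ 𝟙-× (simple2Path? A u v w) (A v v ℕ.≟ 0) ⟩
      𝟙 (simple2Path? A u v w) * noLoop v          ≡⟨ cong (_* noLoop v) (trans (𝟙-× (single? A u v) _)
                                                        (cong (sg u v *_) (𝟙-× (single? A v w) (ne? u w)))) ⟩
      sg u v * (sg v w * ne u w) * noLoop v        ≡⟨ *-comm _ (noLoop v) ⟩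
      noLoop v * (sg u v * (sg v w * ne u w))      ∎

  bEmpty≡ : bEmpty A ≡ ∑ cherries
  bEmpty≡ = trans (∑-swap (λ u v → ∑ (λ w → 𝟙 (simple2Path? A u v w ×-dec (A v v ℕ.≟ 0)))))
                  (∑-cong (λ v → trans (∑-cong (λ u → paths-through u v)) (per-centre v)))
    where
    per-centre : ∀ v → ∑ (λ u → noLoop v * (sg v u * (S v ∸ 1))) ≡ cherries v
    per-centre v = trans (∑-*ˡ (noLoop v) (λ u → sg v u * (S v ∸ 1)))
                         (cong (noLoop v *_) (∑-*ʳ (S v ∸ 1) (sg v)))

  -- The ℓ-switchings counted by fℓ: tuples (a, p, c, b, e) = (v₁, …, v₅) of
  -- distinct vertices with a loop at p, single edges a b and c e, and non-edges
  -- a p, p c and b e.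
  Switching : Fin n → Fin n → Fin n → Fin n → Fin n → Set
  Switching a p c b e =
    (a ≢ p × a ≢ c × a ≢ b × a ≢ e × p ≢ c × p ≢ b × p ≢ e × c ≢ b × c ≢ e × b ≢ e)
    × A p p ≡ 1 × (a ≢ b × A a b ≡ 1) × (c ≢ e × A c e ≡ 1)
    × (a ≢ p × A a p ≡ 0) × (p ≢ c × A p c ≡ 0) × (b ≢ e × A b e ≡ 0)

  switching? : ∀ a p c b e → Dec (Switching a p c b e)
  switching? a p c b e = distinct5? a p c b e
    ×-dec ((A p p ℕ.≟ 1)
    ×-dec (single? A a b ×-dec (single? A c e
    ×-dec (nonEdge? A a p ×-dec (nonEdge? A p c ×-dec nonEdge? A b e)))))

  sw : Fin n → Fin n → Fin n → Fin n → Fin n → ℕ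
  sw a p c b e = 𝟙 (switching? a p c b e)

  atLoop : Fin n → ℕ
  atLoop p = ∑⁴ (λ a b c e → sw a p c b e)

  fℓ-by-loop : fℓ A ≡ ∑ atLoop
  fℓ-by-loop = trans (∑-swap (λ a p → ∑ (λ c → ∑ (λ b → ∑ (sw a p c b)))))
                     (∑-cong (λ p → ∑-cong (λ a → ∑-swap (λ c b → ∑ (sw a p c b)))))

  sw≤ : ∀ a p c b e → sw a p c b e ≤ L p * (sg a b * sg c e)
  sw≤ a p c b e = ≤-trans
    (𝟙-mono (λ (_ , l , s₁ , s₂ , _) → l , s₁ , s₂) (switching? a p c b e)
            ((A p p ℕ.≟ 1) ×-dec (single? A a b ×-dec single? A c e)))
    (≤-reflexive (trans (𝟙-× (A p p ℕ.≟ 1) _) (cong (L p *_) (𝟙-× (single? A a b) (single? A c e)))))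

  obstructions : Fin n → Fin n → Fin n → Fin n → Fin n → ℕ
  obstructions p a b c e = N[ p ] a + N[ p ] c + N[ b ] e + δ c a + δ e a + δ c b

  -- Without obstructions the distinctness conditions follow from the edges.
  switching-intro : ∀ {a p c b e} → A p p ≡ 1 → a ≢ b × A a b ≡ 1 → c ≢ e × A c e ≡ 1 →
                    p ≢ a × A p a ≡ 0 → p ≢ c × A p c ≡ 0 → b ≢ e × A b e ≡ 0 →
                    c ≢ a → e ≢ a → c ≢ b → Switching a p c b e
  switching-intro loop (a≢b , ab) (c≢e , ce) (p≢a , pa) (p≢c , pc) (b≢e , be) c≢a e≢a c≢b =
      (≢-sym p≢a , ≢-sym c≢a , a≢b , ≢-sym e≢a , p≢c , p≢b , p≢e , c≢b , c≢e , b≢e)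
    , loop , (a≢b , ab) , (c≢e , ce) , (≢-sym p≢a , trans (A-sym _ _) pa) , (p≢c , pc) , (b≢e , be)
    where
    p≢b : _ ≢ _
    p≢b refl = 0≢1+n (trans (sym pa) (trans (A-sym _ _) ab))
    p≢e : _ ≢ _
    p≢e refl = 0≢1+n (trans (sym pc) (trans (A-sym _ _) ce))

  obstruction-or-switching : ∀ {a p c b e} → A p p ≡ 1 → a ≢ b × A a b ≡ 1 → c ≢ e × A c e ≡ 1 →
                             1 ≤ obstructions p a b c e + sw a p c b e
  obstruction-or-switching {a} {p} {c} {b} {e} loop ab ce
    with nonEdge? A p a | nonEdge? A p c | nonEdge? A b e | c Fin.≟ a | e Fin.≟ a | c Fin.≟ b
  ... | no _  | _     | _     | _     | _     | _     = s≤s z≤n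
  ... | yes _ | no _  | _     | _     | _     | _     = s≤s z≤n
  ... | yes _ | yes _ | no _  | _     | _     | _     = s≤s z≤n
  ... | yes _ | yes _ | yes _ | yes _ | _     | _     = s≤s z≤n
  ... | yes _ | yes _ | yes _ | no _  | yes _ | _     = s≤s z≤n
  ... | yes _ | yes _ | yes _ | no _  | no _  | yes _ = s≤s z≤n
  ... | yes pa | yes pc | yes be | no c≢a | no e≢a | no c≢b =
    ≤-reflexive (sym (𝟙-yes _ (switching-intro loop ab ce pa pc be c≢a e≢a c≢b)))

  pair-switches : ∀ {p} → A p p ≡ 1 → ∀ a b c e →
                  sg a b * sg c e ≤ sw a p c b e + sg a b * sg c e * obstructions p a b c e
  pair-switches loop a b c e = union-bound
    (*-mono-≤ (𝟙≤1 (single? A a b)) (𝟙≤1 (single? A c e)))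
    (λ both → obstruction-or-switching loop
                (𝟙≡1⇒ (single? A a b) (m*n≡1⇒m≡1 (sg a b) (sg c e) both))
                (𝟙≡1⇒ (single? A c e) (m*n≡1⇒n≡1 (sg a b) (sg c e) both)))

  pairs-count : ∑⁴ (λ a b c e → sg a b * sg c e) ≡ T * T
  pairs-count = trans (∑²-cong (λ a b → ∑²-*ˡ (sg a b) sg)) (∑²-*ʳ T sg)

  module Degrees (d : Fin n → ℕ) (has-d : HasDegrees A d) where

    row≤Δ : ∀ x → ∑ (A x) ≤ Δ d
    row≤Δ x = ≤-trans (m≤m+n (∑ (A x)) (A x x)) (≤-trans (≤-reflexive (has-d x)) (maxF-≥ d x))

    S≤Δ : ∀ x → S x ≤ Δ d
    S≤Δ x = ≤-trans (∑-mono (sg≤A x)) (row≤Δ x)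

    d-split : ∀ u → d u ≡ 2 * L u + S u + 2 * D u
    d-split u = trans (sym (has-d u)) (degree-split u)

    M-split : Msum d ≡ 2 * numLoops A + T + 2 * (2 * numDoubles A)
    M-split = begin
      ∑ d                                             ≡⟨ ∑-cong d-split ⟩
      ∑ (λ u → 2 * L u + S u + 2 * D u)               ≡⟨ ∑-+ (λ u → 2 * L u + S u) (λ u → 2 * D u) ⟩
      ∑ (λ u → 2 * L u + S u) + ∑ (λ u → 2 * D u)     ≡⟨ cong₂ _+_ (∑-+ (λ u → 2 * L u) S) (∑-*ˡ 2 D) ⟩
      ∑ (λ u → 2 * L u) + T + 2 * ∑ D                 ≡⟨ cong₂ (λ x y → x + T + 2 * y) (∑-*ˡ 2 L) doubles-twice ⟩
      2 * numLoops A + T + 2 * (2 * numDoubles A)     ∎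
      where open ≡-Reasoning

    T≤M : T ≤ Msum d
    T≤M = ≤-trans (m≤n+m T (2 * numLoops A)) (≤-trans (m≤m+n _ _) (≤-reflexive (sym M-split)))

    nb : Fin n → ℕ
    nb x = ∑ (λ y → S y * N[ x ] y)

    nb≤ : ∀ x → nb x ≤ Δ d + Δ d * Δ d
    nb≤ x = begin
      ∑ (λ y → S y * N[ x ] y)                          ≤⟨ ∑-mono (λ y → *-monoʳ-≤ (S y) (N≤ x y)) ⟩
      ∑ (λ y → S y * (δ y x + A x y))                   ≡⟨ ∑-cong (λ y → *-distribˡ-+ (S y) (δ y x) (A x y)) ⟩
      ∑ (λ y → S y * δ y x + S y * A x y)               ≡⟨ ∑-+ (λ y → S y * δ y x) (λ y → S y * A x y) ⟩
      ∑ (λ y → S y * δ y x) + ∑ (λ y → S y * A x y)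
        ≤⟨ +-mono-≤ (≤-reflexive (∑-δ S x)) (∑-mono (λ y → *-monoˡ-≤ (A x y) (S≤Δ y))) ⟩
      S x + ∑ (λ y → Δ d * A x y)                       ≡⟨ cong (S x +_) (∑-*ˡ (Δ d) (A x)) ⟩
      S x + Δ d * ∑ (A x)                               ≤⟨ +-mono-≤ (S≤Δ x) (*-monoʳ-≤ (Δ d) (row≤Δ x)) ⟩
      Δ d + Δ d * Δ d                                   ∎
      where open ≤-Reasoning

    -- b_ℓ(G,∅).  A vertex contributes d(d − 1) to M₂; without a loop it has
    -- d = S + 2D, so it loses at most 2D·2Δ paths to double edges, and a looped
    -- vertex loses at most Δ².
    cherries≤ : ∀ v → cherries v ≤ d v * (d v ∸ 1)
    cherries≤ v = begin
      noLoop v * (S v * (S v ∸ 1)) ≤⟨ *-monoˡ-≤ _ (𝟙≤1 (A v v ℕ.≟ 0)) ⟩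
      1 * (S v * (S v ∸ 1))        ≡⟨ *-identityˡ _ ⟩
      S v * (S v ∸ 1)              ≤⟨ *-mono-≤ S≤d (∸-monoˡ-≤ 1 S≤d) ⟩
      d v * (d v ∸ 1)              ∎
      where
      open ≤-Reasoning
      S≤d : S v ≤ d v
      S≤d = ≤-trans (m≤n+m (S v) (2 * L v)) (≤-trans (m≤m+n _ _) (≤-reflexive (sym (d-split v))))

    cherries≥ : ∀ v → d v * (d v ∸ 1) ≤ cherries v + 2 * D v * (2 * Δ d) + L v * (Δ d * Δ d)
    cherries≥ v with loop-cases v
    ... | inj₁ no-loop = begin
      d v * (d v ∸ 1)                                ≡⟨ cong (λ x → x * (x ∸ 1)) d≡ ⟩
      (S v + 2 * D v) * (S v + 2 * D v ∸ 1)
        ≤⟨ ordered-pairs-growth (S v) (2 * D v) (Δ d) (subst (_≤ Δ d) d≡ (maxF-≥ d v)) ⟩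
      S v * (S v ∸ 1) + 2 * D v * (2 * Δ d)          ≡⟨ e (S v * (S v ∸ 1)) (2 * D v * (2 * Δ d)) ⟩
      1 * (S v * (S v ∸ 1)) + 2 * D v * (2 * Δ d) + 0 * (Δ d * Δ d)
        ≡⟨ cong₂ (λ x y → x * (S v * (S v ∸ 1)) + 2 * D v * (2 * Δ d) + y * (Δ d * Δ d))
                 (sym (𝟙-yes (A v v ℕ.≟ 0) no-loop)) (sym no-L) ⟩
      cherries v + 2 * D v * (2 * Δ d) + L v * (Δ d * Δ d) ∎
      where
      open ≤-Reasoning
      no-L : L v ≡ 0
      no-L = trans (sym (loop≡L v)) no-loop
      d≡ : d v ≡ S v + 2 * D v
      d≡ = trans (d-split v) (cong (λ l → 2 * l + S v + 2 * D v) no-L)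
      e : ∀ x y → x + y ≡ 1 * x + y + 0
      e = solve-∀
    ... | inj₂ loop = begin
      d v * (d v ∸ 1)                                       ≤⟨ *-mono-≤ (maxF-≥ d v) (≤-trans (m∸n≤m (d v) 1) (maxF-≥ d v)) ⟩
      Δ d * Δ d                                             ≤⟨ m≤n+m _ _ ⟩
      cherries v + 2 * D v * (2 * Δ d) + Δ d * Δ d          ≡⟨ cong (cherries v + 2 * D v * (2 * Δ d) +_) (*-identityˡ _) ⟨
      cherries v + 2 * D v * (2 * Δ d) + 1 * (Δ d * Δ d)    ≡⟨ cong (λ l → cherries v + 2 * D v * (2 * Δ d) + l * (Δ d * Δ d)) L≡1 ⟨
      cherries v + 2 * D v * (2 * Δ d) + L v * (Δ d * Δ d)  ∎
      where
      open ≤-Reasoning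
      L≡1 : L v ≡ 1
      L≡1 = trans (sym (loop≡L v)) loop

    b∅-upper : bEmpty A ≤ M₂ d
    b∅-upper = ≤-trans (≤-reflexive bEmpty≡) (∑-mono cherries≤)

    b∅-lower : M₂ d ≤ bEmpty A + 8 * numDoubles A * Δ d + numLoops A * (Δ d * Δ d)
    b∅-lower = begin
      ∑ (λ v → d v * (d v ∸ 1))
        ≤⟨ ∑-mono cherries≥ ⟩
      ∑ (λ v → cherries v + 2 * D v * (2 * Δ d) + L v * (Δ d * Δ d))
        ≡⟨ trans (∑-+ (λ v → cherries v + 2 * D v * (2 * Δ d)) (λ v → L v * (Δ d * Δ d)))
                 (cong (_+ ∑ (λ v → L v * (Δ d * Δ d))) (∑-+ cherries (λ v → 2 * D v * (2 * Δ d)))) ⟩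
      ∑ cherries + ∑ (λ v → 2 * D v * (2 * Δ d)) + ∑ (λ v → L v * (Δ d * Δ d))
        ≡⟨ cong₂ _+_ (cong₂ _+_ (sym bEmpty≡) doubles) (∑-*ʳ (Δ d * Δ d) L) ⟩
      bEmpty A + 2 * (2 * numDoubles A) * (2 * Δ d) + numLoops A * (Δ d * Δ d)
        ≡⟨ cong (λ x → bEmpty A + x + numLoops A * (Δ d * Δ d)) (e (numDoubles A) (Δ d)) ⟩
      bEmpty A + 8 * numDoubles A * Δ d + numLoops A * (Δ d * Δ d)
        ∎
      where
      open ≤-Reasoning
      doubles : ∑ (λ v → 2 * D v * (2 * Δ d)) ≡ 2 * (2 * numDoubles A) * (2 * Δ d)
      doubles = trans (∑-*ʳ (2 * Δ d) (λ v → 2 * D v)) (cong (_* (2 * Δ d)) (trans (∑-*ˡ 2 D) (cong (2 *_) doubles-twice)))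
      e : ∀ m Δ → 2 * (2 * m) * (2 * Δ) ≡ 8 * m * Δ
      e = solve-∀

    -- The hypotheses m₁ M ≤ M₂ and m₂ M² ≤ M₂² bound m₁ by Δ − 1 and m₂ by
    -- (Δ − 1)², since M₂ ≤ (Δ − 1) M.
    M₂≤ : M₂ d ≤ (Δ d ∸ 1) * Msum d
    M₂≤ = begin
      ∑ (λ i → d i * (d i ∸ 1))  ≤⟨ ∑-mono (λ i → *-monoʳ-≤ (d i) (∸-monoˡ-≤ 1 (maxF-≥ d i))) ⟩
      ∑ (λ i → d i * (Δ d ∸ 1))  ≡⟨ ∑-*ʳ (Δ d ∸ 1) d ⟩
      Msum d * (Δ d ∸ 1)         ≡⟨ *-comm (Msum d) (Δ d ∸ 1) ⟩
      (Δ d ∸ 1) * Msum d         ∎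
      where open ≤-Reasoning

    loops-bound : numLoops A * Msum d ≤ M₂ d → numLoops A ≤ Δ d ∸ 1
    loops-bound h = cancel-≤ (≤-trans h M₂≤) (λ M≡0 → n≤0⇒n≡0 (subst (numLoops A ≤_) M≡0 loops≤M))
      where
      loops≤M : numLoops A ≤ Msum d
      loops≤M = ≤-trans (m≤m+n _ _) (≤-trans (m≤m+n (2 * numLoops A) T)
                  (≤-trans (m≤m+n _ _) (≤-reflexive (sym M-split))))

    doubles-bound : numDoubles A * (Msum d * Msum d) ≤ M₂ d * M₂ d →
                    numDoubles A ≤ (Δ d ∸ 1) * (Δ d ∸ 1)
    doubles-bound h = cancel-≤ (≤-trans h (≤-trans (*-mono-≤ M₂≤ M₂≤) (≤-reflexive (e (Δ d ∸ 1) (Msum d)))))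
                               (λ MM≡0 → n≤0⇒n≡0 (subst (numDoubles A ≤_) (square≡0 MM≡0) doubles≤M))
      where
      e : ∀ x M → (x * M) * (x * M) ≡ (x * x) * (M * M)
      e = solve-∀
      square≡0 : Msum d * Msum d ≡ 0 → Msum d ≡ 0
      square≡0 MM≡0 = [ id , id ]′ (m*n≡0⇒m≡0∨n≡0 (Msum d) MM≡0)
      doubles≤M : numDoubles A ≤ Msum d
      doubles≤M = ≤-trans (m≤m+n (numDoubles A) _) (≤-trans (m≤m+n (2 * numDoubles A) _)
                    (≤-trans (m≤n+m _ (2 * numLoops A + T)) (≤-reflexive (sym M-split))))

    module TwoPath (u v w : Fin n) (path : Simple2Path A u v w) where

      Avoiding : Fin n → Fin n → Set
      Avoiding a b = (a ≢ b × A a b ≡ 1) × a ≢ u × a ≢ v × a ≢ w × b ≢ u × b ≢ v × b ≢ w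
                     × (u ≢ a × A u a ≡ 0) × (w ≢ b × A w b ≡ 0)

      avoiding? : ∀ a b → Dec (Avoiding a b)
      avoiding? a b = single? A a b
        ×-dec (ne? a u ×-dec (ne? a v ×-dec (ne? a w
        ×-dec (ne? b u ×-dec (ne? b v ×-dec (ne? b w
        ×-dec (nonEdge? A u a ×-dec nonEdge? A w b)))))))

      -- A single edge a b with a outside N[u] and b outside N[w] avoids u, v, w:
      -- a = v or b = u would be joined to u, and b = v or a = w to w.
      avoiding-intro : ∀ {a b} → a ≢ b × A a b ≡ 1 → u ≢ a × A u a ≡ 0 → w ≢ b × A w b ≡ 0 → Avoiding a b
      avoiding-intro {a} {b} (a≢b , ab) (u≢a , ua) (w≢b , wb) =
        (a≢b , ab) , ≢-sym u≢a , a≢v , a≢w , b≢u , b≢v , ≢-sym w≢b , (u≢a , ua) , (w≢b , wb)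
        where
        a≢v : a ≢ v
        a≢v refl = 0≢1+n (trans (sym ua) (proj₂ (proj₁ path)))
        b≢v : b ≢ v
        b≢v refl = 0≢1+n (trans (sym wb) (trans (A-sym w v) (proj₂ (proj₁ (proj₂ path)))))
        a≢w : a ≢ w
        a≢w refl = 0≢1+n (trans (sym wb) ab)
        b≢u : b ≢ u
        b≢u refl = 0≢1+n (trans (sym ua) (trans (A-sym u a) ab))

      obstruction-or-avoiding : ∀ {a b} → a ≢ b × A a b ≡ 1 → 1 ≤ N[ u ] a + N[ w ] b + 𝟙 (avoiding? a b)
      obstruction-or-avoiding {a} {b} ab with nonEdge? A u a | nonEdge? A w b
      ... | no _   | _      = s≤s z≤n
      ... | yes _  | no _   = s≤s z≤n
      ... | yes ua | yes wb = ≤-reflexive (sym (𝟙-yes _ (avoiding-intro ab ua wb)))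

      edge-avoids : ∀ a b → sg a b + sg a b * (N[ u ] a * N[ w ] b)
                            ≤ 𝟙 (avoiding? a b) + sg a b * N[ u ] a + sg a b * N[ w ] b
      edge-avoids a b = inclusion-exclusion (𝟙≤1 (single? A a b)) (𝟙≤1 (¬? (nonEdge? A u a))) (𝟙≤1 (¬? (nonEdge? A w b)))
                          (λ s → obstruction-or-avoiding (𝟙≡1⇒ (single? A a b) s))

      -- The single edges u v and v w lie in both events.
      both-events : 2 ≤ edgeSum (λ a b → N[ u ] a * N[ w ] b)
      both-events = begin
        2                                   ≡⟨ cong₂ _+_ uv vw ⟨
        F u v + F v w                       ≤⟨ +-mono-≤ (∑-term (F u) v) (∑-term (F v) w) ⟩
        ∑ (F u) + ∑ (F v)                   ≤⟨ ∑-two-terms (λ a → ∑ (F a)) (proj₁ (proj₁ path)) ⟩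
        edgeSum (λ a b → N[ u ] a * N[ w ] b) ∎
        where
        open ≤-Reasoning
        F : Fin n → Fin n → ℕ
        F a b = sg a b * (N[ u ] a * N[ w ] b)
        uv : F u v ≡ 1
        uv = trans (cong₂ (λ s x → s * (x * N[ w ] v)) (𝟙-yes (single? A u v) (proj₁ path)) (N-self u))
                   (cong (λ y → 1 * (1 * y)) (N-single w v (trans (A-sym w v) (proj₂ (proj₁ (proj₂ path))))))
        vw : F v w ≡ 1
        vw = trans (cong₂ (λ s y → s * (N[ u ] v * y)) (𝟙-yes (single? A v w) (proj₁ (proj₂ path))) (N-self w))
                   (cong (λ x → 1 * (x * 1)) (N-single u v (proj₂ (proj₁ path))))

      avoiding-count : T + 2 ≤ bPath A u v w + nb u + nb w
      avoiding-count = begin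
        T + 2                                                 ≤⟨ +-monoʳ-≤ T both-events ⟩
        T + edgeSum (λ a b → N[ u ] a * N[ w ] b)             ≡⟨ ∑²-+ sg (λ a b → sg a b * (N[ u ] a * N[ w ] b)) ⟨
        ∑² (λ a b → sg a b + sg a b * (N[ u ] a * N[ w ] b))  ≤⟨ ∑²-mono edge-avoids ⟩
        ∑² (λ a b → 𝟙 (avoiding? a b) + sg a b * N[ u ] a + sg a b * N[ w ] b)
          ≡⟨ trans (∑²-+ (λ a b → 𝟙 (avoiding? a b) + sg a b * N[ u ] a) (λ a b → sg a b * N[ w ] b))
                   (cong (_+ edgeSum (λ a b → N[ w ] b)) (∑²-+ (λ a b → 𝟙 (avoiding? a b)) (λ a b → sg a b * N[ u ] a))) ⟩
        bPath A u v w + edgeSum (λ a b → N[ u ] a) + edgeSum (λ a b → N[ w ] b)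
          ≡⟨ cong₂ (λ x y → bPath A u v w + x + y) (edgeSum-left N[ u ]) (edgeSum-right N[ w ]) ⟩
        bPath A u v w + nb u + nb w                           ∎
        where open ≤-Reasoning

      -- b_ℓ(G,uvw) counts some ordered single edges, and M + 4Δ ≤ b_ℓ + 6Δ² by
      -- the count above together with S ≤ Δ, M = 2m₁ + T + 4m₂ and Δ ≥ S u ≥ 1.
      two-path-upper : bPath A u v w ≤ Msum d
      two-path-upper = ≤-trans (∑²-mono (λ a b → 𝟙-mono proj₁ (avoiding? a b) (single? A a b))) T≤M

      two-path-lower : numLoops A ≤ Δ d ∸ 1 → numDoubles A ≤ (Δ d ∸ 1) * (Δ d ∸ 1) →
                       Msum d + 4 * Δ d ≤ bPath A u v w + 6 * (Δ d * Δ d)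
      two-path-lower m₁≤ m₂≤ = subst (λ M → M + 4 * Δ d ≤ bPath A u v w + 6 * (Δ d * Δ d)) (sym M-split)
        (two-path-arith {T} {bPath A u v w} {numLoops A} {numDoubles A} (Δ d) Δ≥1 m₁≤ m₂≤
           (≤-trans avoiding-count (+-mono-≤ (+-monoʳ-≤ (bPath A u v w) (nb≤ u)) (nb≤ w))))
        where
        Δ≥1 : 1 ≤ Δ d
        Δ≥1 = ≤-trans (≤-reflexive (sym (𝟙-yes (single? A u v) (proj₁ path)))) (≤-trans (∑-term (sg u) v) (S≤Δ u))

    -- For a looped vertex p, the obstructions to switching with a fixed
    -- single edge a b, summed over all single edges c e: T·[a ∈ N[p]] for a,
    -- at most Δ + Δ² each for c ∈ N[p] and e ∈ N[b], and at most Δ for each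
    -- coincidence.
    obstructions-per-edge : ∀ p a b → edgeSum (obstructions p a b)
                            ≤ T * N[ p ] a + (Δ d + Δ d * Δ d) + (Δ d + Δ d * Δ d) + Δ d + Δ d + Δ d
    obstructions-per-edge p a b =
      edgeSum-+≤ (edgeSum-+≤ (edgeSum-+≤ (edgeSum-+≤ (edgeSum-+≤
        (≤-reflexive (edgeSum-const (N[ p ] a)))
        (≤-trans (≤-reflexive (edgeSum-left N[ p ])) (nb≤ p)))
        (≤-trans (≤-reflexive (edgeSum-right N[ b ])) (nb≤ b)))
        (coincidence a (edgeSum-left (λ c → δ c a))))
        (coincidence a (edgeSum-right (λ e → δ e a))))
        (coincidence b (edgeSum-left (λ c → δ c b)))
      where
      coincidence : ∀ x {s} → s ≡ ∑ (λ y → S y * δ y x) → s ≤ Δ d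
      coincidence x s≡ = ≤-trans (≤-reflexive (trans s≡ (∑-δ S x))) (S≤Δ x)

    obstruction-budget : ℕ
    obstruction-budget = 3 * (Δ d * Δ d) + 6 * Δ d

    obstruction-count : ∀ p → ∑⁴ (λ a b c e → sg a b * sg c e * obstructions p a b c e) ≤ T * obstruction-budget
    obstruction-count p = begin
      ∑⁴ (λ a b c e → sg a b * sg c e * obstructions p a b c e)
        ≡⟨ ∑²-cong (λ a b → trans (∑²-cong (λ c e → *-assoc (sg a b) (sg c e) (obstructions p a b c e)))
                                   (∑²-*ˡ (sg a b) (λ c e → sg c e * obstructions p a b c e))) ⟩
      edgeSum (λ a b → edgeSum (obstructions p a b))
        ≤⟨ edgeSum-mono (obstructions-per-edge p) ⟩
      edgeSum (λ a b → T * N[ p ] a + B + B + Δ d + Δ d + Δ d)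
        ≤⟨ edgeSum-+≤ (edgeSum-+≤ (edgeSum-+≤ (edgeSum-+≤ (edgeSum-+≤ loop-neighbours (const B)) (const B))
                       (const (Δ d))) (const (Δ d))) (const (Δ d)) ⟩
      T * B + T * B + T * B + T * Δ d + T * Δ d + T * Δ d  ≡⟨ e T (Δ d) ⟩
      T * obstruction-budget                               ∎
      where
      open ≤-Reasoning
      B : ℕ
      B = Δ d + Δ d * Δ d
      e : ∀ T Δ → T * (Δ + Δ * Δ) + T * (Δ + Δ * Δ) + T * (Δ + Δ * Δ) + T * Δ + T * Δ + T * Δ
                  ≡ T * (3 * (Δ * Δ) + 6 * Δ)
      e = solve-∀
      const : ∀ k → edgeSum (λ _ _ → k) ≤ T * k
      const k = ≤-reflexive (edgeSum-const k)
      loop-neighbours : edgeSum (λ a b → T * N[ p ] a) ≤ T * B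
      loop-neighbours = begin
        edgeSum (λ a b → T * N[ p ] a)   ≡⟨ edgeSum-left (λ a → T * N[ p ] a) ⟩
        ∑ (λ a → S a * (T * N[ p ] a))   ≡⟨ ∑-cong (λ a → x∙yz≈y∙xz (S a) T (N[ p ] a)) ⟩
        ∑ (λ a → T * (S a * N[ p ] a))   ≡⟨ ∑-*ˡ T (λ a → S a * N[ p ] a) ⟩
        T * nb p                         ≤⟨ *-monoʳ-≤ T (nb≤ p) ⟩
        T * B                            ∎

    atLoop-upper : ∀ p → atLoop p ≤ L p * (T * T)
    atLoop-upper p = ≤-trans (∑⁴-mono (λ a b c e → sw≤ a p c b e))
      (≤-reflexive (trans (∑⁴-*ˡ (L p) (λ a b c e → sg a b * sg c e)) (cong (L p *_) pairs-count)))

    atLoop-lower : ∀ p → L p * (T * T) ≤ atLoop p + L p * (T * obstruction-budget)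
    atLoop-lower p = by-loop (A p p ℕ.≟ 1)
      where
      by-loop : (l : Dec (A p p ≡ 1)) → 𝟙 l * (T * T) ≤ atLoop p + 𝟙 l * (T * obstruction-budget)
      by-loop (no _) = z≤n
      by-loop (yes loop) = begin
        1 * (T * T)                                ≡⟨ *-identityˡ (T * T) ⟩
        T * T                                      ≡⟨ pairs-count ⟨
        ∑⁴ (λ a b c e → sg a b * sg c e)           ≤⟨ ∑⁴-mono (pair-switches loop) ⟩
        ∑⁴ (λ a b c e → sw a p c b e + sg a b * sg c e * obstructions p a b c e)
          ≡⟨ ∑⁴-+ (λ a b c e → sw a p c b e) (λ a b c e → sg a b * sg c e * obstructions p a b c e) ⟩
        atLoop p + ∑⁴ (λ a b c e → sg a b * sg c e * obstructions p a b c e)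
          ≤⟨ +-monoʳ-≤ (atLoop p) (obstruction-count p) ⟩
        atLoop p + T * obstruction-budget          ≡⟨ cong (atLoop p +_) (*-identityˡ _) ⟨
        atLoop p + 1 * (T * obstruction-budget)    ∎
        where open ≤-Reasoning

    -- Summing over the loops: m₁T² − m₁T·budget ≤ f_ℓ ≤ m₁T² ≤ m₁M², and with
    -- M = T + 2m₁ + 4m₂ the lower bound becomes m₁M² − m₁M(11Δ² − 4Δ + 4).
    switch-upper : fℓ A ≤ numLoops A * (Msum d * Msum d)
    switch-upper = begin
      fℓ A                            ≡⟨ fℓ-by-loop ⟩
      ∑ atLoop                        ≤⟨ ∑-mono atLoop-upper ⟩
      ∑ (λ p → L p * (T * T))         ≡⟨ ∑-*ʳ (T * T) L ⟩
      numLoops A * (T * T)            ≤⟨ *-monoʳ-≤ (numLoops A) (*-mono-≤ T≤M T≤M) ⟩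
      numLoops A * (Msum d * Msum d)  ∎
      where open ≤-Reasoning

    switch-count-lower : numLoops A * (T * T) ≤ fℓ A + numLoops A * (T * obstruction-budget)
    switch-count-lower = begin
      numLoops A * (T * T)                                         ≡⟨ ∑-*ʳ (T * T) L ⟨
      ∑ (λ p → L p * (T * T))                                      ≤⟨ ∑-mono atLoop-lower ⟩
      ∑ (λ p → atLoop p + L p * (T * obstruction-budget))
        ≡⟨ ∑-+ atLoop (λ p → L p * (T * obstruction-budget)) ⟩
      ∑ atLoop + ∑ (λ p → L p * (T * obstruction-budget))
        ≡⟨ cong₂ _+_ (sym fℓ-by-loop) (∑-*ʳ (T * obstruction-budget) L) ⟩
      fℓ A + numLoops A * (T * obstruction-budget)                 ∎
      where open ≤-Reasoning

    switch-lower : numLoops A ≤ Δ d ∸ 1 → numDoubles A ≤ (Δ d ∸ 1) * (Δ d ∸ 1) →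
                   numLoops A * (Msum d * Msum d) ≤ fℓ A + numLoops A * Msum d * switching-constant (Δ d)
    switch-lower m₁≤ m₂≤ =
      subst (λ M → numLoops A * (M * M) ≤ fℓ A + numLoops A * M * switching-constant (Δ d)) (sym M≡T+X)
            (switching-arith {numLoops A} {T} {_} {fℓ A} (Δ d) m₁≤ X≤ switch-count-lower)
      where
      X≤ : 2 * numLoops A + 2 * (2 * numDoubles A) ≤ 2 * (Δ d ∸ 1) + 2 * (2 * ((Δ d ∸ 1) * (Δ d ∸ 1)))
      X≤ = +-mono-≤ (*-monoʳ-≤ 2 m₁≤) (*-monoʳ-≤ 2 (*-monoʳ-≤ 2 m₂≤))
      e : ∀ l t m → 2 * l + t + 2 * (2 * m) ≡ t + (2 * l + 2 * (2 * m))
      e = solve-∀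
      M≡T+X : Msum d ≡ T + (2 * numLoops A + 2 * (2 * numDoubles A))
      M≡T+X = trans M-split (e (numLoops A) T (numDoubles A))

-- The integer form of the three lower bounds, obtained from their
-- natural-number versions by moving the subtracted terms across.
module IntegerForm where

  import Data.Nat as ℕ
  open import Data.Integer using (ℤ; +_; _+_; _-_; _*_; -_; +≤+) renaming (_≤_ to _≤ℤ_)
  open import Data.Integer.Properties using (+-monoˡ-≤; pos-+; pos-*)
  open import Relation.Binary.PropositionalEquality
  open import Data.Integer.Tactic.RingSolver using (solve-∀)
  open Arithmetic using (switching-constant)

  add-both : ∀ {x y} (z : ℤ) {x′ y′} → x ≤ℤ y → x + z ≡ x′ → y + z ≡ y′ → x′ ≤ℤ y′
  add-both z h refl refl = +-monoˡ-≤ z h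

  switching-constant-ℤ : ∀ Δ → + switching-constant Δ ≡ + 11 * (+ Δ * + Δ) - + 4 * + Δ + + 4
  switching-constant-ℤ ℕ.zero    = refl
  switching-constant-ℤ (ℕ.suc k) = begin
    + (11 ℕ.* (k ℕ.* k) ℕ.+ 18 ℕ.* k ℕ.+ 11)
      ≡⟨ pos-+ (11 ℕ.* (k ℕ.* k) ℕ.+ 18 ℕ.* k) 11 ⟩
    + (11 ℕ.* (k ℕ.* k) ℕ.+ 18 ℕ.* k) + + 11
      ≡⟨ cong (λ z → z + + 11) (trans (pos-+ (11 ℕ.* (k ℕ.* k)) (18 ℕ.* k))
                               (cong₂ _+_ (trans (pos-* 11 (k ℕ.* k)) (cong (λ z → + 11 * z) (pos-* k k))) (pos-* 18 k))) ⟩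
    + 11 * (+ k * + k) + + 18 * + k + + 11
      ≡⟨ e (+ k) ⟩
    + 11 * ((+ 1 + + k) * (+ 1 + + k)) - + 4 * (+ 1 + + k) + + 4 ∎
    where
    open ≡-Reasoning
    e : ∀ x → + 11 * (x * x) + + 18 * x + + 11 ≡ + 11 * ((+ 1 + x) * (+ 1 + x)) - + 4 * (+ 1 + x) + + 4
    e = solve-∀

  b∅-form : ∀ {M₂ b m₁ m₂ Δ} → M₂ ℕ.≤ b ℕ.+ 8 ℕ.* m₂ ℕ.* Δ ℕ.+ m₁ ℕ.* (Δ ℕ.* Δ) →
            + M₂ - + 8 * + m₂ * + Δ - + m₁ * (+ Δ * + Δ) ≤ℤ + b
  b∅-form {M₂} {b} {m₁} {m₂} {Δ} h = add-both (- (+ 8 * + m₂ * + Δ) - + m₁ * (+ Δ * + Δ)) (+≤+ h)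
    (e₁ (+ M₂) (+ 8 * + m₂ * + Δ) (+ m₁ * (+ Δ * + Δ)))
    (trans (cong (_+ (- (+ 8 * + m₂ * + Δ) - + m₁ * (+ Δ * + Δ))) cast)
           (e₂ (+ b) (+ 8 * + m₂ * + Δ) (+ m₁ * (+ Δ * + Δ))))
    where
    e₁ : ∀ x c l → x + (- c - l) ≡ x - c - l
    e₁ = solve-∀
    e₂ : ∀ y c l → y + c + l + (- c - l) ≡ y
    e₂ = solve-∀
    cast : + (b ℕ.+ 8 ℕ.* m₂ ℕ.* Δ ℕ.+ m₁ ℕ.* (Δ ℕ.* Δ)) ≡ + b + + 8 * + m₂ * + Δ + + m₁ * (+ Δ * + Δ)
    cast = trans (pos-+ (b ℕ.+ 8 ℕ.* m₂ ℕ.* Δ) (m₁ ℕ.* (Δ ℕ.* Δ)))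
             (cong₂ _+_ (trans (pos-+ b (8 ℕ.* m₂ ℕ.* Δ))
                               (cong (λ z → + b + z) (trans (pos-* (8 ℕ.* m₂) Δ) (cong (λ z → z * + Δ) (pos-* 8 m₂)))))
                        (trans (pos-* m₁ (Δ ℕ.* Δ)) (cong (+ m₁ *_) (pos-* Δ Δ))))

  b-path-form : ∀ {M b Δ} → M ℕ.+ 4 ℕ.* Δ ℕ.≤ b ℕ.+ 6 ℕ.* (Δ ℕ.* Δ) →
                + M - + 6 * (+ Δ * + Δ) + + 4 * + Δ ≤ℤ + b
  b-path-form {M} {b} {Δ} h = add-both (- (+ 6 * (+ Δ * + Δ))) (+≤+ h)
    (trans (cong (_+ - (+ 6 * (+ Δ * + Δ))) cast-l) (e₁ (+ M) (+ 6 * (+ Δ * + Δ)) (+ 4 * + Δ)))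
    (trans (cong (_+ - (+ 6 * (+ Δ * + Δ))) cast-r) (e₂ (+ b) (+ 6 * (+ Δ * + Δ))))
    where
    e₁ : ∀ x c f → x + f + - c ≡ x - c + f
    e₁ = solve-∀
    e₂ : ∀ y c → y + c + - c ≡ y
    e₂ = solve-∀
    cast-l : + (M ℕ.+ 4 ℕ.* Δ) ≡ + M + + 4 * + Δ
    cast-l = trans (pos-+ M (4 ℕ.* Δ)) (cong (λ z → + M + z) (pos-* 4 Δ))
    cast-r : + (b ℕ.+ 6 ℕ.* (Δ ℕ.* Δ)) ≡ + b + + 6 * (+ Δ * + Δ)
    cast-r = trans (pos-+ b (6 ℕ.* (Δ ℕ.* Δ)))
                   (cong (λ z → + b + z) (trans (pos-* 6 (Δ ℕ.* Δ)) (cong (λ z → + 6 * z) (pos-* Δ Δ))))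

  fℓ-form : ∀ {m M f Δ} → m ℕ.* (M ℕ.* M) ℕ.≤ f ℕ.+ m ℕ.* M ℕ.* switching-constant Δ →
            + m * (+ M * + M) - + m * + M * (+ 11 * (+ Δ * + Δ) - + 4 * + Δ + + 4) ≤ℤ + f
  fℓ-form {m} {M} {f} {Δ} h = add-both (- (+ m * + M * C)) (+≤+ h)
    (cong (_+ - (+ m * + M * C)) (trans (pos-* m (M ℕ.* M)) (cong (λ z → + m * z) (pos-* M M))))
    (trans (cong (_+ - (+ m * + M * C)) cast) (e (+ f) (+ m * + M * C)))
    where
    C : ℤ
    C = + 11 * (+ Δ * + Δ) - + 4 * + Δ + + 4
    e : ∀ y c → y + c + - c ≡ y
    e = solve-∀
    cast : + (f ℕ.+ m ℕ.* M ℕ.* switching-constant Δ) ≡ + f + + m * + M * C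
    cast = trans (pos-+ f (m ℕ.* M ℕ.* switching-constant Δ))
             (cong (λ z → + f + z) (trans (pos-* (m ℕ.* M) (switching-constant Δ))
                                   (cong₂ _*_ (pos-* m M) (switching-constant-ℤ Δ))))

open import Data.Integer using (ℤ; +_; _+_; _-_; _*_) renaming (_≤_ to _≤ℤ_)
import Data.Nat as ℕ

lemma4p3 : ∀ (n : ℕ) (d : Fin n → ℕ) (m₁ m₂ : ℕ) (A : MultiGraph n) →
    InG d m₁ m₂ A →
    m₁ ℕ.* Msum d ≤ M₂ d →
    m₂ ℕ.* (Msum d ℕ.* Msum d) ≤ M₂ d ℕ.* M₂ d →
    ((+ M₂ d - + 8 * + m₂ * + Δ d - + m₁ * (+ Δ d * + Δ d) ≤ℤ + bEmpty A)
      × bEmpty A ≤ M₂ d)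
    × (∀ (u v w : Fin n) → Simple2Path A u v w →
        (+ Msum d - + 6 * (+ Δ d * + Δ d) + + 4 * + Δ d ≤ℤ + bPath A u v w)
        × bPath A u v w ≤ Msum d)
    × ((+ m₁ * (+ Msum d * + Msum d)
          - + m₁ * + Msum d * (+ 11 * (+ Δ d * + Δ d) - + 4 * + Δ d + + 4) ≤ℤ + fℓ A)
       × fℓ A ≤ m₁ ℕ.* (Msum d ℕ.* Msum d))
lemma4p3 n d m₁ m₂ A (A-sym , has-d , loop≤1 , mult≤2 , refl , refl) m₁M≤M₂ m₂M²≤M₂² =
    (IntegerForm.b∅-form {M₂ d} {bEmpty A} {numLoops A} {numDoubles A} {Δ d} b∅-lower , b∅-upper)
  , (λ u v w path → IntegerForm.b-path-form {Msum d} {bPath A u v w} {Δ d} (TwoPath.two-path-lower u v w path m₁≤ m₂≤)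
                  , TwoPath.two-path-upper u v w path)
  , (IntegerForm.fℓ-form {numLoops A} {Msum d} {fℓ A} {Δ d} (switch-lower m₁≤ m₂≤) , switch-upper)
  where
  open Structure A A-sym loop≤1 mult≤2
  open Degrees d has-d
  m₁≤ : numLoops A ≤ Δ d ℕ.∸ 1
  m₁≤ = loops-bound m₁M≤M₂
  m₂≤ : numDoubles A ≤ (Δ d ℕ.∸ 1) ℕ.* (Δ d ℕ.∸ 1)
  m₂≤ = doubles-bound m₂M²≤M₂²
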